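{- There are instances $I=(G,S,k)$ of Maximal Admissible Subset Enumeration for which there are $2^{\mu(I)}$ preferred extensions of $G$ that are subsets of $S$ at distance at most $k$ from $S$ (i.e. $|S\setminus T|\le k$), where $\mu(I)=\frac{k}{2}+\frac{r(G[S])}{4}$.
   Context: An argumentation framework is a finite digraph $G=(V,E)$; an arc $(u,v)$ means $u$ attacks $v$. A set $T\subseteq V$ is conflict-free if no arc has both endpoints in $T$; a vertex $v$ is acceptable with respect to $T$ if for every arc $(u,v)\in E$ there is an arc $(w,u)\in E$ with $w\in T$; $T$ is admissible if it is conflict-free and each of its vertices is acceptable with respect to $T$; a preferred extension is an inclusion-wise maximal admissible set. $r(H)$ is the number of vertices of $H$ on at least one 2-cycle; $G[S]$ is the subdigraph induced by $S$. An instance of Maximal Admissible Subset Enumeration is a triple $(G,S,k)$ with $G$ a digraph, $S\subseteq V(G)$ and $k$ an integer. -}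

module Defs where

open import Data.Nat using (ℕ)
open import Data.Bool using (Bool; true; false; _∧_; not)
open import Data.Fin using (Fin)
open import Data.Fin.Properties using (_≟_)
open import Data.Fin.Subset using (Subset; _∈_; _⊆_; ∣_∣; _─_)
open import Data.Vec using (tabulate; lookup)
open import Data.List using (allFin)
open import Data.Bool.ListAction using (any)
open import Data.Product using (Σ; ∃; _×_)
open import Relation.Nullary using (¬_)
open import Relation.Nullary.Decidable using (⌊_⌋)
open import Relation.Binary.PropositionalEquality using (_≡_)

-- A finite digraph (argumentation framework) on vertex set Fin n,
-- given by its (decidable) arc relation: arc u v means u attacks v.
Digraph : ℕ → Set
Digraph n = Fin n → Fin n → Bool

module _ {n : ℕ} (G : Digraph n) where

  Arc : Fin n → Fin n → Set
  Arc u v = G u v ≡ true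

  ConflictFree : Subset n → Set
  ConflictFree T = ∀ u v → u ∈ T → v ∈ T → ¬ Arc u v

  Acceptable : Fin n → Subset n → Set
  Acceptable v T = ∀ u → Arc u v → Σ (Fin n) λ w → (w ∈ T) × Arc w u

  Admissible : Subset n → Set
  Admissible T = ConflictFree T × (∀ v → v ∈ T → Acceptable v T)

  Preferred : Subset n → Set
  Preferred T = Admissible T × (∀ T' → Admissible T' → T ⊆ T' → T' ⊆ T)

  -- r(G[S]): number of vertices of G[S] lying on a 2-cycle of G[S]
  -- (a 2-cycle is u → v → u with u ≢ v; both u, v in S).
  r : Subset n → ℕ
  r S = ∣ tabulate (λ v → lookup S v ∧
           any (λ u → not ⌊ u ≟ v ⌋ ∧ lookup S u ∧ G u v ∧ G v u) (allFin n)) ∣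

  GoodExtension : Subset n → ℕ → Subset n → Set
  GoodExtension S k T = Preferred T × T ⊆ S × (∣ S ─ T ∣ Data.Nat.≤ k)

-- Take t disjoint 2-cycles {x, σ x}. A set containing exactly one vertex of
-- each cycle is conflict-free, defends itself (each member counter-attacks its
-- only attacker) and cannot be enlarged without swallowing a whole 2-cycle;
-- hence each of the 2^t such sets is a preferred extension. With S the whole
-- vertex set and k = t, every one of them misses exactly t vertices of S,
-- while r(G[S]) ≤ 2t, so 2k + r(G[S]) ≤ 4t and 2^t ≥ 2^μ.
module Submission where

open import Defs
open import Data.Bool using (Bool; true; false; not)
open import Data.Bool.Properties using (T-≡; not-involutive)
open import Data.Empty using (⊥-elim)
open import Data.Fin using (Fin; zero; suc; combine; funToFin; finToFun)
open import Data.Fin.Properties using (_≟_; 2↔Bool; funToFin-finToFin)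
open import Data.Fin.Subset using (Subset; _∈_; _⊆_; ⊤; _─_; ∣_∣)
open import Data.Fin.Subset.Properties using (∣p∣≤n; ⊆⊤)
open import Data.Nat using (ℕ; zero; suc; _≤_; _+_; _*_; _^_)
open import Data.Nat.Properties
  using (≤-trans; ≤-reflexive; m≤m+n; +-monoʳ-≤; ^-monoʳ-≤; ^-*-assoc; module ≤-Reasoning)
open import Data.Nat.Solver using (module +-*-Solver)
open import Data.Product using (Σ; _×_; _,_)
open import Data.Vec using ([]; _∷_; lookup; tabulate)
open import Data.Vec.Properties using ([]=⇒lookup; lookup⇒[]=; ∷-injectiveˡ; ∷-injectiveʳ)
open import Function using (_∘_; case_of_)
open import Function.Bundles using (Inverse; Injection; Equivalence)
open import Function.Definitions using (Injective)
open import Function.Properties.Inverse using (↔⇒↣)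
open import Relation.Binary.PropositionalEquality
  using (_≡_; refl; sym; trans; cong; cong₂; subst₂; _≗_; module ≡-Reasoning)
open import Relation.Nullary.Decidable using (⌊_⌋; fromWitness; toWitness)

module _ {n : ℕ} (σ : Fin n → Fin n) where

  partnerGraph : Digraph n
  partnerGraph u v = ⌊ σ u ≟ v ⌋

  IsTransversal : Subset n → Set
  IsTransversal T = ∀ x → lookup T (σ x) ≡ not (lookup T x)

module _ {n : ℕ} {σ : Fin n → Fin n} where

  arc⇒partner : ∀ {u v} → Arc (partnerGraph σ) u v → σ u ≡ v
  arc⇒partner a = toWitness (Equivalence.from T-≡ a)

  arc-partner : ∀ u → Arc (partnerGraph σ) u (σ u)
  arc-partner u = Equivalence.to T-≡ (fromWitness refl)

  transversal⇒conflictFree : ∀ {T} → IsTransversal σ T → ConflictFree (partnerGraph σ) T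
  transversal⇒conflictFree {T} tr u v u∈T v∈T a = case begin
    true             ≡⟨ []=⇒lookup v∈T ⟨
    lookup T v       ≡⟨ cong (lookup T) (arc⇒partner a) ⟨
    lookup T (σ u)   ≡⟨ tr u ⟩
    not (lookup T u) ≡⟨ cong not ([]=⇒lookup u∈T) ⟩
    false            ∎ of λ ()
    where open ≡-Reasoning

  involutive⇒acceptable : (∀ x → σ (σ x) ≡ x) → ∀ {T} v → v ∈ T → Acceptable (partnerGraph σ) v T
  involutive⇒acceptable σ-involutive v v∈T u a =
    v , v∈T , subst₂ (Arc (partnerGraph σ)) (arc⇒partner a) (σ-involutive u) (arc-partner (σ u))

  transversal⇒maximal : ∀ {T} → IsTransversal σ T →
                        ∀ T′ → Admissible (partnerGraph σ) T′ → T ⊆ T′ → T′ ⊆ T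
  transversal⇒maximal {T} tr T′ (cf′ , _) T⊆T′ {x} x∈T′ with lookup T x in T[x]≡
  ... | true  = lookup⇒[]= x T T[x]≡
  ... | false = ⊥-elim (cf′ x (σ x) x∈T′ (T⊆T′ σx∈T) (arc-partner x))
    where
    σx∈T : σ x ∈ T
    σx∈T = lookup⇒[]= (σ x) T (trans (tr x) (cong not T[x]≡))

  transversal⇒preferred : (∀ x → σ (σ x) ≡ x) → ∀ {T} → IsTransversal σ T → Preferred (partnerGraph σ) T
  transversal⇒preferred σ-involutive tr =
    (transversal⇒conflictFree tr , involutive⇒acceptable σ-involutive) , transversal⇒maximal tr

swapPairs : ∀ t → Fin (t * 2) → Fin (t * 2)
swapPairs (suc t) zero          = suc zero
swapPairs (suc t) (suc zero)    = zero
swapPairs (suc t) (suc (suc x)) = suc (suc (swapPairs t x))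

swapPairs-involutive : ∀ t (x : Fin (t * 2)) → swapPairs t (swapPairs t x) ≡ x
swapPairs-involutive (suc t) zero          = refl
swapPairs-involutive (suc t) (suc zero)    = refl
swapPairs-involutive (suc t) (suc (suc x)) = cong (λ y → suc (suc y)) (swapPairs-involutive t x)

oneOfEachPair : ∀ {t} → (Fin t → Bool) → Subset (t * 2)
oneOfEachPair {zero}  c = []
oneOfEachPair {suc t} c = c zero ∷ not (c zero) ∷ oneOfEachPair (c ∘ suc)

oneOfEachPair-isTransversal : ∀ {t} (c : Fin t → Bool) → IsTransversal (swapPairs t) (oneOfEachPair c)
oneOfEachPair-isTransversal {suc t} c zero          = refl
oneOfEachPair-isTransversal {suc t} c (suc zero)    = sym (not-involutive (c zero))
oneOfEachPair-isTransversal {suc t} c (suc (suc x)) = oneOfEachPair-isTransversal (c ∘ suc) x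

oneOfEachPair-injective : ∀ {t} {c c′ : Fin t → Bool} → oneOfEachPair c ≡ oneOfEachPair c′ → c ≗ c′
oneOfEachPair-injective {suc t} e zero    = ∷-injectiveˡ e
oneOfEachPair-injective {suc t} e (suc i) = oneOfEachPair-injective (∷-injectiveʳ (∷-injectiveʳ e)) i

∣⊤─oneOfEachPair∣≡ : ∀ {t} (c : Fin t → Bool) → ∣ ⊤ ─ oneOfEachPair c ∣ ≡ t
∣⊤─oneOfEachPair∣≡ {zero}  c = refl
∣⊤─oneOfEachPair∣≡ {suc t} c with c zero
... | true  = cong suc (∣⊤─oneOfEachPair∣≡ (c ∘ suc))
... | false = cong suc (∣⊤─oneOfEachPair∣≡ (c ∘ suc))

funToFin-cong : ∀ {m n} {f g : Fin m → Fin n} → f ≗ g → funToFin f ≡ funToFin g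
funToFin-cong {zero}  f≗g = refl
funToFin-cong {suc m} f≗g = cong₂ combine (f≗g zero) (funToFin-cong (f≗g ∘ suc))

finToFun-injective : ∀ m n {i j : Fin (m ^ n)} → finToFun {m} {n} i ≗ finToFun j → i ≡ j
finToFun-injective m n {i} {j} eq = begin
  i                               ≡⟨ funToFin-finToFin {n} {m} i ⟨
  funToFin (finToFun {m} {n} i)   ≡⟨ funToFin-cong eq ⟩
  funToFin (finToFun {m} {n} j)   ≡⟨ funToFin-finToFin {n} {m} j ⟩
  j                               ∎
  where open ≡-Reasoning

choiceOf : ∀ t → Fin (2 ^ t) → Fin t → Bool
choiceOf t i = Inverse.to 2↔Bool ∘ finToFun {2} {t} i

choiceOf-injective : ∀ t {i j : Fin (2 ^ t)} → choiceOf t i ≗ choiceOf t j → i ≡ j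
choiceOf-injective t eq = finToFun-injective 2 t (Injection.injective (↔⇒↣ 2↔Bool) ∘ eq)

r≤n : ∀ {n} (G : Digraph n) S → r G S ≤ n
r≤n G S = ∣p∣≤n (tabulate _)

2^[2k+x]≤[2^k]^4 : ∀ k {x} → x ≤ k * 2 → 2 ^ (2 * k + x) ≤ (2 ^ k) ^ 4
2^[2k+x]≤[2^k]^4 k {x} x≤2k = begin
  2 ^ (2 * k + x)      ≤⟨ ^-monoʳ-≤ 2 (+-monoʳ-≤ (2 * k) x≤2k) ⟩
  2 ^ (2 * k + k * 2)  ≡⟨ cong (2 ^_) (solve 1 (λ k → con 2 :* k :+ k :* con 2 := k :* con 4) refl k) ⟩
  2 ^ (k * 4)          ≡⟨ ^-*-assoc 2 k 4 ⟨
  (2 ^ k) ^ 4          ∎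
  where open ≤-Reasoning
        open +-*-Solver

mainTheorem15 : (m : ℕ) →
    Σ ℕ λ n → Σ (Digraph n) λ G → Σ (Subset n) λ S → Σ ℕ λ k →
      m ≤ 2 * k + r G S ×
      Σ ℕ λ N → Σ (Fin N → Subset n) λ f →
        Injective _≡_ _≡_ f ×
        (∀ i → GoodExtension G S k (f i)) ×
        2 ^ (2 * k + r G S) ≤ N ^ 4
mainTheorem15 m =
  m * 2 , G , ⊤ , m , ≤-trans (m≤m+n m _) (m≤m+n (2 * m) _) ,
  2 ^ m , oneOfEachPair ∘ choiceOf m ,
  choiceOf-injective m ∘ oneOfEachPair-injective ,
  good , 2^[2k+x]≤[2^k]^4 m (r≤n G ⊤)
  where
  G : Digraph (m * 2)
  G = partnerGraph (swapPairs m)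

  good : ∀ i → GoodExtension G ⊤ m (oneOfEachPair (choiceOf m i))
  good i = transversal⇒preferred (swapPairs-involutive m) (oneOfEachPair-isTransversal (choiceOf m i)) ,
           ⊆⊤ , ≤-reflexive (∣⊤─oneOfEachPair∣≡ (choiceOf m i))
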